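{- For any integers $r\ge t\ge 2$, there exists a connected graph $G$ such that ${\rm gp}(G)=r$ and $\omega(G_{\rm SR})=t$.
   Context: All graphs are finite and simple. For a connected graph $G$, a set $S\subseteq V(G)$ is a general position set if no three pairwise distinct vertices of $S$ lie on a common geodesic of $G$; ${\rm gp}(G)$ is the maximum cardinality of a general position set. A vertex $u$ is maximally distant from $v$ if every neighbor $w$ of $u$ satisfies $d_G(v,w)\le d_G(u,v)$; $u,v$ are mutually maximally distant (MMD) if each is maximally distant from the other. The strong resolving graph $G_{\rm SR}$ has vertex set $V(G)$, two vertices adjacent iff they are MMD in $G$. $\omega$ is the clique number. -}

module Defs where

open import Data.Nat using (ℕ; zero; suc; _+_; _≤_)
open import Data.Fin using (Fin)
open import Data.Fin.Subset using (Subset; _∈_; ∣_∣)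
open import Data.Bool using (Bool; true; false; T)
open import Data.Product using (Σ; ∃; _×_; _,_)
open import Relation.Binary.PropositionalEquality using (_≡_; _≢_)
open import Relation.Nullary using (¬_)

record Graph : Set where
  field
    n     : ℕ
    adj   : Fin n → Fin n → Bool
    sym   : ∀ u v → adj u v ≡ adj v u
    irref : ∀ u → adj u u ≡ false

open Graph public

Vertex : Graph → Set
Vertex G = Fin (n G)

Adj : (G : Graph) → Vertex G → Vertex G → Set
Adj G u v = T (adj G u v)

data Walk (G : Graph) : Vertex G → Vertex G → ℕ → Set where
  here : ∀ {u} → Walk G u u zero
  step : ∀ {u w v k} → Adj G u w → Walk G w v k → Walk G u v (suc k)

Connected : Graph → Set
Connected G = ∀ u v → ∃ λ k → Walk G u v k

Dist : (G : Graph) → Vertex G → Vertex G → ℕ → Set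
Dist G u v k = Walk G u v k × (∀ m → Walk G u v m → k ≤ m)

OnGeodesic : (G : Graph) → Vertex G → Vertex G → Vertex G → Set
OnGeodesic G u w v = ∃ λ a → ∃ λ b → ∃ λ c →
  Dist G u w a × Dist G w v b × Dist G u v c × (a + b ≡ c)

-- General position set: no three pairwise distinct vertices of S lie on a
-- common geodesic (i.e. none of them lies on a geodesic between the other two).
GeneralPosition : (G : Graph) → Subset (n G) → Set
GeneralPosition G S = ∀ u w v → u ∈ S → w ∈ S → v ∈ S →
  u ≢ w → w ≢ v → u ≢ v → ¬ OnGeodesic G u w v

GpNumber : Graph → ℕ → Set
GpNumber G r =
  (Σ (Subset (n G)) λ S → GeneralPosition G S × ∣ S ∣ ≡ r) ×
  (∀ S → GeneralPosition G S → ∣ S ∣ ≤ r)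

MaxDistant : (G : Graph) → Vertex G → Vertex G → Set
MaxDistant G u v = ∀ w → Adj G u w → ∀ a b → Dist G v w a → Dist G u v b → a ≤ b

MMD : (G : Graph) → Vertex G → Vertex G → Set
MMD G u v = MaxDistant G u v × MaxDistant G v u

SRAdj : (G : Graph) → Vertex G → Vertex G → Set
SRAdj G u v = u ≢ v × MMD G u v

SRClique : (G : Graph) → Subset (n G) → Set
SRClique G S = ∀ u v → u ∈ S → v ∈ S → u ≢ v → SRAdj G u v

SRCliqueNumber : Graph → ℕ → Set
SRCliqueNumber G t =
  (Σ (Subset (n G)) λ S → SRClique G S × ∣ S ∣ ≡ t) ×
  (∀ S → SRClique G S → ∣ S ∣ ≤ t)

-- Take a clique C = {c₀,…,c_{r-1}}, a clique Z = {z₀,…,z_{m-1}}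
-- and a surjective "class" map cls : C → Z, and join every cᵢ to z_{cls i}.
-- Every vertex is within distance 2 of every other, so distances are 0, 1, 2.
--
-- C is in general position (any three vertices of a
-- clique form a triangle).  Conversely a general position set S has at most
-- r vertices: if S contains an edge cᵢ z_{cls i}, then S lies inside
-- {z_{cls i}} ∪ cls⁻¹(cls i), which injects into C because another class is
-- non-empty (m ≥ 2); otherwise cᵢ ↦ i, z_j ↦ (a preimage of j) is injective.
--
-- Two cᵢ's in one class are twins, hence MMD; cᵢ and
-- z_j with cls i ≠ j are non-adjacent at the maximal distance 2, hence MMD;
-- two z's, or two c's in different classes, are not MMD.  So a clique of G_SR
-- is one class plus at most one z.  Choosing one class of size t - 1 and
-- r - t + 1 singleton classes gives ω(G_SR) = t.

module Submission where

open import Defs hiding (sym)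
open import Data.Bool using (Bool; false; T; not)
open import Data.Empty using (⊥-elim)
open import Data.Fin using (Fin; zero; suc; splitAt; join; _↑ˡ_; _↑ʳ_; inject₁; fromℕ; _≟_; punchOut)
open import Data.Fin.Properties using (splitAt-↑ˡ; splitAt-↑ʳ; splitAt⁻¹-↑ˡ; splitAt⁻¹-↑ʳ; splitAt-join; ↑ˡ-injective; ↑ʳ-injective; suc-injective; punchOut-injective; inject₁-injective; fromℕ≢inject₁; any?)
open import Data.Fin.Subset using (Subset; _∈_; ∣_∣; inside; outside; ⊤; ⊥)
open import Data.Fin.Subset.Properties using (_∈?_; ∣⊤∣≡n; ∣⊥∣≡0; ∉⊥)
open import Data.Nat using (ℕ; zero; suc; _+_; _≤_; z≤n; s≤s)
open import Data.Nat.Properties using (≤-trans; +-mono-≤; +-identityʳ; +-suc; +-comm; m≤n⇒∃[o]m+o≡n)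
open import Data.Product using (Σ; ∃; _×_; _,_; proj₁; proj₂; swap)
open import Data.Sum using (_⊎_; inj₁; inj₂; [_,_]′)
open import Data.Vec using ([]; _∷_; _++_; here; there)
open import Data.Vec.Properties using (lookup-++ˡ; lookup-++ʳ; []=⇒lookup; lookup⇒[]=)
open import Relation.Binary.PropositionalEquality
open import Relation.Nullary using (¬_; Dec; yes; no)
open import Relation.Nullary.Decidable using (isYes; isNo; toWitness; fromWitness; fromWitnessFalse)

isYes-⇔ : {A B : Set} → (A → B) → (B → A) → (a? : Dec A) (b? : Dec B) → isYes a? ≡ isYes b?
isYes-⇔ f g (yes a) (yes b) = refl
isYes-⇔ f g (yes a) (no ¬b) = ⊥-elim (¬b (f a))
isYes-⇔ f g (no ¬a) (yes b) = ⊥-elim (¬a (g b))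
isYes-⇔ f g (no ¬a) (no ¬b) = refl

isNo-≟-refl : ∀ {n} (i : Fin n) → isNo (i ≟ i) ≡ false
isNo-≟-refl i with i ≟ i
... | yes _ = refl
... | no i≢i = ⊥-elim (i≢i refl)

module GraphFacts (G : Graph) where

  adj⇒≢ : ∀ {u v} → Adj G u v → u ≢ v
  adj⇒≢ {u} a refl with adj G u u | irref G u
  ... | false | refl = a

  adj-sym : ∀ {u v} → Adj G u v → Adj G v u
  adj-sym {u} {v} = subst T (Graph.sym G u v)

  walk≥1 : ∀ {u v k} → u ≢ v → Walk G u v k → 1 ≤ k
  walk≥1 u≢v here = ⊥-elim (u≢v refl)
  walk≥1 u≢v (step _ _) = s≤s z≤n

  walk≥2 : ∀ {u v k} → u ≢ v → ¬ Adj G u v → Walk G u v k → 2 ≤ k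
  walk≥2 u≢v u≁v here = ⊥-elim (u≢v refl)
  walk≥2 u≢v u≁v (step a here) = ⊥-elim (u≁v a)
  walk≥2 u≢v u≁v (step _ (step _ _)) = s≤s (s≤s z≤n)

  dist-1 : ∀ {u v} → Adj G u v → Dist G u v 1
  dist-1 a = step a here , λ _ → walk≥1 (adj⇒≢ a)

  dist-2 : ∀ {u w v} → u ≢ v → ¬ Adj G u v → Adj G u w → Adj G w v → Dist G u v 2
  dist-2 u≢v u≁v a b = step a (step b here) , λ _ → walk≥2 u≢v u≁v

  Diameter≤2 : Set
  Diameter≤2 = ∀ u v → ∃ λ k → k ≤ 2 × Walk G u v k

  diameter≤2⇒connected : Diameter≤2 → Connected G
  diameter≤2⇒connected d u v = proj₁ (d u v) , proj₂ (proj₂ (d u v))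

  -- If every neighbour of u other than v is a neighbour of v, then u is
  -- maximally distant from v (its neighbours are at distance ≤ 1 from v).
  maxDistant-twin : ∀ {u v} → u ≢ v → (∀ w → Adj G u w → w ≡ v ⊎ Adj G v w) → MaxDistant G u v
  maxDistant-twin u≢v nbrs w u~w a b (_ , dvw-min) (walk-uv , _) with nbrs w u~w
  ... | inj₁ refl = ≤-trans (dvw-min 0 here) z≤n
  ... | inj₂ v~w = ≤-trans (dvw-min 1 (step v~w here)) (walk≥1 u≢v walk-uv)

  -- In a graph of diameter 2, distinct non-adjacent vertices are at the
  -- maximal distance, so each is maximally distant from the other.
  maxDistant-far : Diameter≤2 → ∀ {u v} → u ≢ v → ¬ Adj G u v → MaxDistant G u v
  maxDistant-far d {u} {v} u≢v u≁v w _ a b (_ , dvw-min) (walk-uv , _) with d v w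
  ... | k , k≤2 , walk-vw = ≤-trans (dvw-min k walk-vw) (≤-trans k≤2 (walk≥2 u≢v u≁v walk-uv))

  ¬maxDistant : ∀ {u v w} → Adj G u v → Adj G u w → w ≢ v → ¬ Adj G v w → ¬ MaxDistant G u v
  ¬maxDistant u~v u~w w≢v v≁w md
    with md _ u~w 2 1 (dist-2 (λ e → w≢v (sym e)) v≁w (adj-sym u~v) u~w) (dist-1 u~v)
  ... | s≤s ()

  path-geodesic : ∀ {u w v} → Adj G u w → Adj G w v → ¬ Adj G u v → u ≢ v → OnGeodesic G u w v
  path-geodesic a b u≁v u≢v = 1 , 1 , 2 , dist-1 a , dist-1 b , dist-2 u≢v u≁v a b , refl

  triangle-¬geodesic : ∀ {u w v} → Adj G u w → Adj G w v → Adj G u v → ¬ OnGeodesic G u w v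
  triangle-¬geodesic u~w w~v u~v (a , b , c , (walk-uw , _) , (walk-wv , _) , (_ , duv-min) , a+b≡c)
    with ≤-trans (+-mono-≤ (walk≥1 (adj⇒≢ u~w) walk-uw) (walk≥1 (adj⇒≢ w~v) walk-wv))
                 (subst (_≤ 1) (sym a+b≡c) (duv-min 1 (step u~v here)))
  ... | s≤s ()

injection⇒∣S∣≤ : ∀ {n r} (S : Subset n) (f : ∀ u → u ∈ S → Fin r) →
  (∀ u v (p : u ∈ S) (q : v ∈ S) → f u p ≡ f v q → u ≡ v) → ∣ S ∣ ≤ r
injection⇒∣S∣≤ [] f inj = z≤n
injection⇒∣S∣≤ (outside ∷ S) f inj =
  injection⇒∣S∣≤ S (λ u p → f (suc u) (there p))
    (λ u v p q e → suc-injective (inj (suc u) (suc v) (there p) (there q) e))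
injection⇒∣S∣≤ {r = zero} (inside ∷ S) f inj with f zero here
... | ()
injection⇒∣S∣≤ {r = suc r} (inside ∷ S) f inj = s≤s (injection⇒∣S∣≤ S f′ inj′)
  where
  -- The head's image is avoided by the tail, so the tail injects into the
  -- remaining r values.
  avoids-head : ∀ u (p : u ∈ S) → f zero here ≢ f (suc u) (there p)
  avoids-head u p e with inj zero (suc u) here (there p) e
  ... | ()
  f′ : ∀ u → u ∈ S → Fin r
  f′ u p = punchOut (avoids-head u p)
  inj′ : ∀ u v (p : u ∈ S) (q : v ∈ S) → f′ u p ≡ f′ v q → u ≡ v
  inj′ u v p q e = suc-injective (inj (suc u) (suc v) (there p) (there q)
    (punchOut-injective (avoids-head u p) (avoids-head v q) e))

∣++∣ : ∀ {a b} (A : Subset a) (B : Subset b) → ∣ A ++ B ∣ ≡ ∣ A ∣ + ∣ B ∣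
∣++∣ [] B = refl
∣++∣ (outside ∷ A) B = ∣++∣ A B
∣++∣ (inside ∷ A) B = cong suc (∣++∣ A B)

data Block (a b : ℕ) : Fin (a + b) → Set where
  left  : (i : Fin a) → Block a b (i ↑ˡ b)
  right : (j : Fin b) → Block a b (a ↑ʳ j)

block : ∀ a b (u : Fin (a + b)) → Block a b u
block a b u with splitAt a u in eq
... | inj₁ i = subst (Block a b) (splitAt⁻¹-↑ˡ eq) (left i)
... | inj₂ j = subst (Block a b) (splitAt⁻¹-↑ʳ eq) (right j)

↑ˡ≢↑ʳ : ∀ {a b} (i : Fin a) (j : Fin b) → i ↑ˡ b ≢ a ↑ʳ j
↑ˡ≢↑ʳ {a} {b} i j e with trans (sym (splitAt-↑ˡ a i b)) (trans (cong (splitAt a) e) (splitAt-↑ʳ a b j))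
... | ()

onBlocks : ∀ {A : Set} a {b} → (Fin a → A) → (Fin b → A) → Fin (a + b) → A
onBlocks a f g u = [ f , g ]′ (splitAt a u)

onBlocks-↑ˡ : ∀ {A : Set} a {b} (f : Fin a → A) (g : Fin b → A) i → onBlocks a f g (i ↑ˡ b) ≡ f i
onBlocks-↑ˡ a {b} f g i = cong [ f , g ]′ (splitAt-↑ˡ a i b)

onBlocks-↑ʳ : ∀ {A : Set} a {b} (f : Fin a → A) (g : Fin b → A) j → onBlocks a f g (a ↑ʳ j) ≡ g j
onBlocks-↑ʳ a {b} f g j = cong [ f , g ]′ (splitAt-↑ʳ a b j)

∈-++ˡ⁻ : ∀ {a b} (A : Subset a) (B : Subset b) i → i ↑ˡ b ∈ A ++ B → i ∈ A
∈-++ˡ⁻ A B i p = lookup⇒[]= i A (trans (sym (lookup-++ˡ A B i)) ([]=⇒lookup p))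

∈-++ʳ⁻ : ∀ {a b} (A : Subset a) (B : Subset b) j → a ↑ʳ j ∈ A ++ B → j ∈ B
∈-++ʳ⁻ {a} A B j p = lookup⇒[]= j B (trans (sym (lookup-++ʳ A B j)) ([]=⇒lookup p))

LeftBlock : ∀ a b → Subset (a + b)
LeftBlock a b = ⊤ {a} ++ ⊥ {b}

∈LeftBlock : ∀ a b u → u ∈ LeftBlock a b → ∃ λ i → u ≡ i ↑ˡ b
∈LeftBlock a b u p with block a b u
... | left i = i , refl
... | right j = ⊥-elim (∉⊥ (∈-++ʳ⁻ (⊤ {a}) (⊥ {b}) j p))

∣LeftBlock∣ : ∀ a b → ∣ LeftBlock a b ∣ ≡ a
∣LeftBlock∣ a b = begin
  ∣ ⊤ {a} ++ ⊥ {b} ∣    ≡⟨ ∣++∣ (⊤ {a}) (⊥ {b}) ⟩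
  ∣ ⊤ {a} ∣ + ∣ ⊥ {b} ∣ ≡⟨ cong₂ _+_ (∣⊤∣≡n a) (∣⊥∣≡0 b) ⟩
  a + 0                 ≡⟨ +-identityʳ a ⟩
  a                     ∎
  where open ≡-Reasoning

-- Two cliques C (size r) and Z (size m), with cᵢ joined to z_{cls i};
-- g is a section of cls, so every z_j has a neighbour in C.

module PendantCliques (r m : ℕ) (cls : Fin r → Fin m)
                      (g : Fin m → Fin r) (cls∘g : ∀ j → cls (g j) ≡ j) where

  adjL : Fin r ⊎ Fin m → Fin r ⊎ Fin m → Bool
  adjL (inj₁ i) (inj₁ i′) = isNo (i ≟ i′)
  adjL (inj₂ j) (inj₂ j′) = isNo (j ≟ j′)
  adjL (inj₁ i) (inj₂ j) = isYes (cls i ≟ j)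
  adjL (inj₂ j) (inj₁ i) = isYes (cls i ≟ j)

  adjL-sym : ∀ x y → adjL x y ≡ adjL y x
  adjL-sym (inj₁ i) (inj₁ i′) = cong not (isYes-⇔ sym sym (i ≟ i′) (i′ ≟ i))
  adjL-sym (inj₂ j) (inj₂ j′) = cong not (isYes-⇔ sym sym (j ≟ j′) (j′ ≟ j))
  adjL-sym (inj₁ i) (inj₂ j) = refl
  adjL-sym (inj₂ j) (inj₁ i) = refl

  adjL-irrefl : ∀ x → adjL x x ≡ false
  adjL-irrefl (inj₁ i) = isNo-≟-refl i
  adjL-irrefl (inj₂ j) = isNo-≟-refl j

  G : Graph
  G = record { n = r + m ; adj = λ u v → adjL (splitAt r u) (splitAt r v)
             ; sym = λ u v → adjL-sym (splitAt r u) (splitAt r v)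
             ; irref = λ u → adjL-irrefl (splitAt r u) }

  open GraphFacts G

  c : Fin r → Vertex G
  c i = i ↑ˡ m

  z : Fin m → Vertex G
  z j = r ↑ʳ j

  adj-labels : ∀ x y → adjL x y ≡ adj G (join r m x) (join r m y)
  adj-labels x y = sym (cong₂ adjL (splitAt-join r m x) (splitAt-join r m y))

  c~c : ∀ {i i′} → i ≢ i′ → Adj G (c i) (c i′)
  c~c {i} {i′} i≢i′ = subst T (adj-labels (inj₁ i) (inj₁ i′)) (fromWitnessFalse i≢i′)

  z~z : ∀ {j j′} → j ≢ j′ → Adj G (z j) (z j′)
  z~z {j} {j′} j≢j′ = subst T (adj-labels (inj₂ j) (inj₂ j′)) (fromWitnessFalse j≢j′)

  c~z : ∀ {i j} → cls i ≡ j → Adj G (c i) (z j)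
  c~z {i} {j} e = subst T (adj-labels (inj₁ i) (inj₂ j)) (fromWitness e)

  c~z⁻ : ∀ {i j} → Adj G (c i) (z j) → cls i ≡ j
  c~z⁻ {i} {j} a = toWitness (subst T (sym (adj-labels (inj₁ i) (inj₂ j))) a)

  z~c⁻ : ∀ {i j} → Adj G (z j) (c i) → cls i ≡ j
  z~c⁻ a = c~z⁻ (adj-sym a)

  c≢z : ∀ {i j} → c i ≢ z j
  c≢z {i} {j} = ↑ˡ≢↑ʳ i j

  z≢c : ∀ {i j} → z j ≢ c i
  z≢c e = c≢z (sym e)

  c-injective : ∀ {i i′} → c i ≡ c i′ → i ≡ i′
  c-injective = ↑ˡ-injective m _ _

  z-injective : ∀ {j j′} → z j ≡ z j′ → j ≡ j′
  z-injective = ↑ʳ-injective r _ _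

  g-injective : ∀ {j j′} → g j ≡ g j′ → j ≡ j′
  g-injective {j} {j′} e = trans (sym (cls∘g j)) (trans (cong cls e) (cls∘g j′))

  -- Distances: cᵢ reaches z_j through z_{cls i}.
  diameter≤2 : Diameter≤2
  diameter≤2 u v with block r m u | block r m v
  ... | left i | left i′ with i ≟ i′
  ...   | yes refl = 0 , z≤n , here
  ...   | no i≢i′ = 1 , s≤s z≤n , step (c~c i≢i′) here
  diameter≤2 u v | right j | right j′ with j ≟ j′
  ...   | yes refl = 0 , z≤n , here
  ...   | no j≢j′ = 1 , s≤s z≤n , step (z~z j≢j′) here
  diameter≤2 u v | left i | right j with cls i ≟ j
  ...   | yes e = 1 , s≤s z≤n , step (c~z e) here
  ...   | no ne = 2 , s≤s (s≤s z≤n) , step (c~z refl) (step (z~z ne) here)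
  diameter≤2 u v | right j | left i with cls i ≟ j
  ...   | yes e = 1 , s≤s z≤n , step (adj-sym (c~z e)) here
  ...   | no ne = 2 , s≤s (s≤s z≤n) , step (z~z (λ e → ne (sym e))) (step (adj-sym (c~z refl)) here)

  -- Two vertices of one class are twins.
  maxDistant-class : ∀ {i i′} → cls i ≡ cls i′ → i ≢ i′ → MaxDistant G (c i) (c i′)
  maxDistant-class {i} {i′} same i≢i′ = maxDistant-twin (λ e → i≢i′ (c-injective e)) nbrs
    where
    nbrs : ∀ w → Adj G (c i) w → w ≡ c i′ ⊎ Adj G (c i′) w
    nbrs w a with block r m w
    ... | left i″ with i″ ≟ i′
    ...   | yes refl = inj₁ refl
    ...   | no i″≢i′ = inj₂ (c~c (λ e → i″≢i′ (sym e)))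
    nbrs w a | right j = inj₂ (c~z (trans (sym same) (c~z⁻ a)))

  -- cᵢ and z_j with cls i ≠ j are non-adjacent, hence at distance 2.
  mmd-far : ∀ {i j} → cls i ≢ j → MMD G (c i) (z j)
  mmd-far ne = maxDistant-far diameter≤2 c≢z (λ a → ne (c~z⁻ a))
             , maxDistant-far diameter≤2 z≢c (λ a → ne (z~c⁻ a))

  -- c_{g j} is a neighbour of z_j at distance 2 from any other z_{j′}.
  ¬maxDistant-zz : ∀ {j j′} → j ≢ j′ → ¬ MaxDistant G (z j) (z j′)
  ¬maxDistant-zz {j} j≢j′ = ¬maxDistant (z~z j≢j′) (adj-sym (c~z (cls∘g j))) c≢z
    (λ a → j≢j′ (trans (sym (cls∘g j)) (z~c⁻ a)))

  -- z_{cls i} is a neighbour of cᵢ at distance 2 from c_{i′} in another class.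
  ¬maxDistant-cc : ∀ {i i′} → cls i ≢ cls i′ → ¬ MaxDistant G (c i) (c i′)
  ¬maxDistant-cc ne = ¬maxDistant (c~c (λ e → ne (cong cls e))) (c~z refl) z≢c
    (λ a → ne (sym (c~z⁻ a)))

  C-gp : GeneralPosition G (LeftBlock r m)
  C-gp u w v pu pw pv u≢w w≢v u≢v with ∈LeftBlock r m u pu | ∈LeftBlock r m w pw | ∈LeftBlock r m v pv
  ... | i , refl | i′ , refl | i″ , refl =
    triangle-¬geodesic (c~c (λ e → u≢w (cong c e))) (c~c (λ e → w≢v (cong c e)))
                       (c~c (λ e → u≢v (cong c e)))

  Anchored : Subset (r + m) → Set
  Anchored S = ∃ λ i → c i ∈ S × z (cls i) ∈ S

  anchored? : ∀ S → Dec (Anchored S)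
  anchored? S = any? λ i → both (c i ∈? S) (z (cls i) ∈? S)
    where
    both : ∀ {A B : Set} → Dec A → Dec B → Dec (A × B)
    both (yes a) (yes b) = yes (a , b)
    both (no ¬a) _ = no (λ ab → ¬a (proj₁ ab))
    both (yes _) (no ¬b) = no (λ ab → ¬b (proj₂ ab))

  data Star (j : Fin m) : Vertex G → Set where
    centre : Star j (z j)
    leaf   : ∀ i → cls i ≡ j → Star j (c i)

  -- A general position set anchored at cᵢ z_{cls i} lies in the star of cls i:
  -- any other vertex would put cᵢ or z_{cls i} on a geodesic of length 2.
  anchored-star : ∀ S → GeneralPosition G S → ∀ {i} → c i ∈ S → z (cls i) ∈ S →
    ∀ u → u ∈ S → Star (cls i) u
  anchored-star S gp {i} ci∈S zi∈S u p with block r m u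
  ... | right j with j ≟ cls i
  ...   | yes refl = centre
  ...   | no ne = ⊥-elim (gp (z j) (z (cls i)) (c i) p zi∈S ci∈S (λ e → ne (z-injective e)) z≢c z≢c
                (path-geodesic (z~z ne) (adj-sym (c~z refl)) (λ a → ne (sym (z~c⁻ a))) z≢c))
  anchored-star S gp {i} ci∈S zi∈S u p | left i′ with cls i′ ≟ cls i
  ...   | yes e = leaf i′ e
  ...   | no ne = ⊥-elim (gp (c i′) (c i) (z (cls i)) p ci∈S zi∈S (λ e → ne (cong cls (c-injective e))) c≢z c≢z
                (path-geodesic (c~c (λ e → ne (cong cls e))) (c~z refl) (λ a → ne (c~z⁻ a)) c≢z))

  -- A star injects into C when some other class j′ is non-empty:
  -- send z_j to the preimage g j′.
  star-bound : ∀ S j → (∃ λ j′ → j′ ≢ j) → (∀ u → u ∈ S → Star j u) → ∣ S ∣ ≤ r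
  star-bound S j (j′ , j′≢j) star = injection⇒∣S∣≤ S (λ u _ → label u) inj
    where
    label : Vertex G → Fin r
    label = onBlocks r (λ i → i) (λ _ → g j′)
    label-leaf : ∀ i → label (c i) ≡ i
    label-leaf = onBlocks-↑ˡ r _ _
    label-centre : label (z j) ≡ g j′
    label-centre = onBlocks-↑ʳ r _ _ j
    centre≢leaf : ∀ i → cls i ≡ j → g j′ ≢ i
    centre≢leaf i ci≡j e = j′≢j (trans (sym (cls∘g j′)) (trans (cong cls e) ci≡j))
    inj : ∀ u v (p : u ∈ S) (q : v ∈ S) → label u ≡ label v → u ≡ v
    inj u v p q e with star u p | star v q
    ... | centre | centre = refl
    ... | leaf i _ | leaf i′ _ = cong c (trans (sym (label-leaf i)) (trans e (label-leaf i′)))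
    ... | leaf i ci≡j | centre = ⊥-elim (centre≢leaf i ci≡j (trans (sym label-centre) (trans (sym e) (label-leaf i))))
    ... | centre | leaf i ci≡j = ⊥-elim (centre≢leaf i ci≡j (trans (sym label-centre) (trans e (label-leaf i))))

  -- Without an anchoring edge, cᵢ ↦ i and z_j ↦ g j is injective on S.
  unanchored-bound : ∀ S → ¬ Anchored S → ∣ S ∣ ≤ r
  unanchored-bound S unanchored = injection⇒∣S∣≤ S (λ u _ → label u) inj
    where
    label : Vertex G → Fin r
    label = onBlocks r (λ i → i) g
    label-c : ∀ i → label (c i) ≡ i
    label-c = onBlocks-↑ˡ r _ _
    label-z : ∀ j → label (z j) ≡ g j
    label-z = onBlocks-↑ʳ r _ _
    -- cᵢ and z_j share a label only if they form an anchoring edge.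
    not-both : ∀ i j → c i ∈ S → z j ∈ S → label (c i) ≢ label (z j)
    not-both i j p q e = unanchored (i , p , subst (λ x → z x ∈ S) (sym ci≡j) q)
      where
      ci≡j : cls i ≡ j
      ci≡j = trans (cong cls (trans (sym (label-c i)) (trans e (label-z j)))) (cls∘g j)
    inj : ∀ u v (p : u ∈ S) (q : v ∈ S) → label u ≡ label v → u ≡ v
    inj u v p q e with block r m u | block r m v
    ... | left i | left i′ = cong c (trans (sym (label-c i)) (trans e (label-c i′)))
    ... | right j | right j′ = cong z (g-injective (trans (sym (label-z j)) (trans e (label-z j′))))
    ... | left i | right j = ⊥-elim (not-both i j p q e)
    ... | right j | left i = ⊥-elim (not-both i j q p (sym e))

  gp-bound : (∀ j → ∃ λ j′ → j′ ≢ j) → ∀ S → GeneralPosition G S → ∣ S ∣ ≤ r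
  gp-bound other S gp with anchored? S
  ... | yes (i , ci∈S , zi∈S) = star-bound S (cls i) (other (cls i)) (anchored-star S gp ci∈S zi∈S)
  ... | no unanchored = unanchored-bound S unanchored

  -- gp(G) = r as soon as Z has at least two vertices.
  gpNumber : (∀ j → ∃ λ j′ → j′ ≢ j) → GpNumber G r
  gpNumber other = (LeftBlock r m , C-gp , ∣LeftBlock∣ r m) , gp-bound other

-- The specific class map: k = a + 1 vertices in class 0 and s = b + 1
-- singleton classes 1, …, s; so r = k + s, m = s + 1 and ω(G_SR) = k + 1.

module Example (a b : ℕ) where
  k s : ℕ
  k = suc a
  s = suc b

  cls : Fin (k + s) → Fin (suc s)
  cls = onBlocks k (λ _ → zero) suc

  cls-↑ˡ : ∀ x → cls (x ↑ˡ s) ≡ zero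
  cls-↑ˡ = onBlocks-↑ˡ k (λ _ → zero) suc

  cls-↑ʳ : ∀ y → cls (k ↑ʳ y) ≡ suc y
  cls-↑ʳ = onBlocks-↑ʳ k (λ _ → zero) suc

  section : Fin (suc s) → Fin (k + s)
  section zero = zero ↑ˡ s
  section (suc y) = k ↑ʳ y

  cls∘section : ∀ j → cls (section j) ≡ j
  cls∘section zero = cls-↑ˡ zero
  cls∘section (suc y) = cls-↑ʳ y

  two-classes : (j : Fin (suc s)) → ∃ λ (j′ : Fin (suc s)) → j′ ≢ j
  two-classes zero = suc zero , λ ()
  two-classes (suc _) = zero , λ ()

  open PendantCliques (k + s) (suc s) cls section cls∘section public

  -- The clique of G_SR: all of class 0 together with z₁.
  SR-clique : Subset (k + s + suc s)
  SR-clique = LeftBlock k s ++ (outside ∷ inside ∷ ⊥ {b})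

  class-0≢1 : ∀ {i} → cls i ≡ zero → cls i ≢ suc zero
  class-0≢1 ci≡0 ci≡1 with trans (sym ci≡0) ci≡1
  ... | ()

  data InClique : Vertex G → Set where
    class-0 : ∀ i → cls i ≡ zero → InClique (c i)
    z-1     : InClique (z (suc zero))

  inClique : ∀ u → u ∈ SR-clique → InClique u
  inClique u p with block (k + s) (suc s) u
  ... | left i with ∈LeftBlock k s i (∈-++ˡ⁻ (LeftBlock k s) _ i p)
  ...   | x , refl = class-0 i (cls-↑ˡ x)
  inClique u p | right j with j | ∈-++ʳ⁻ (LeftBlock k s) (outside ∷ inside ∷ ⊥ {b}) j p
  ... | suc zero | _ = z-1
  ... | suc (suc y) | there (there y∈⊥) = ⊥-elim (∉⊥ y∈⊥)

  SR-clique-isClique : SRClique G SR-clique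
  SR-clique-isClique u v p q u≢v with inClique u p | inClique v q
  ... | class-0 i ci≡0 | class-0 i′ ci′≡0 =
    u≢v , maxDistant-class (trans ci≡0 (sym ci′≡0)) (λ e → u≢v (cong c e))
        , maxDistant-class (trans ci′≡0 (sym ci≡0)) (λ e → u≢v (cong c (sym e)))
  ... | class-0 i ci≡0 | z-1 = u≢v , mmd-far (class-0≢1 {i} ci≡0)
  ... | z-1 | class-0 i ci≡0 = u≢v , swap (mmd-far (class-0≢1 {i} ci≡0))
  ... | z-1 | z-1 = ⊥-elim (u≢v refl)

  ∣SR-clique∣ : ∣ SR-clique ∣ ≡ suc k
  ∣SR-clique∣ = begin
    ∣ SR-clique ∣                                  ≡⟨ ∣++∣ (LeftBlock k s) (outside ∷ inside ∷ ⊥ {b}) ⟩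
    ∣ LeftBlock k s ∣ + suc ∣ ⊥ {b} ∣              ≡⟨ cong₂ (λ x y → x + suc y) (∣LeftBlock∣ k s) (∣⊥∣≡0 b) ⟩
    k + 1                                          ≡⟨ +-comm k 1 ⟩
    suc k                                          ∎
    where open ≡-Reasoning

  -- A clique of G_SR injects into Fin (k + 1): class-0 vertices by their index,
  -- the singleton-class vertices to 0, Z to k.  Within one class this is
  -- injective, and a clique has at most one vertex of Z.
  classIndex : Fin (k + s) → Fin (suc k)
  classIndex = onBlocks k inject₁ (λ _ → zero)

  classIndex-↑ˡ : ∀ x → classIndex (x ↑ˡ s) ≡ inject₁ x
  classIndex-↑ˡ = onBlocks-↑ˡ k inject₁ (λ _ → zero)

  classIndex-↑ʳ : ∀ y → classIndex (k ↑ʳ y) ≡ zero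
  classIndex-↑ʳ = onBlocks-↑ʳ k inject₁ (λ _ → zero)

  classIndex≢k : ∀ i → classIndex i ≢ fromℕ k
  classIndex≢k i e with block k s i
  ... | left x = fromℕ≢inject₁ (trans (sym e) (classIndex-↑ˡ x))
  ... | right y with trans (sym (classIndex-↑ʳ y)) e
  ...   | ()

  classIndex-injective : ∀ {i i′} → cls i ≡ cls i′ → classIndex i ≡ classIndex i′ → i ≡ i′
  classIndex-injective {i} {i′} same e with block k s i | block k s i′
  ... | left x | left x′ =
    cong (_↑ˡ s) (inject₁-injective (trans (sym (classIndex-↑ˡ x)) (trans e (classIndex-↑ˡ x′))))
  ... | right y | right y′ = cong (k ↑ʳ_) (suc-injective (trans (sym (cls-↑ʳ y)) (trans same (cls-↑ʳ y′))))
  ... | left x | right y with trans (sym (cls-↑ˡ x)) (trans same (cls-↑ʳ y))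
  ...   | ()
  classIndex-injective same e | right y | left x with trans (sym (cls-↑ˡ x)) (trans (sym same) (cls-↑ʳ y))
  ...   | ()

  -- Distinct members of an SR clique are MMD, so they are not two z's, and
  -- two c's among them share a class; hence the index above is injective.
  SR-bound : ∀ S → SRClique G S → ∣ S ∣ ≤ suc k
  SR-bound S clique = injection⇒∣S∣≤ S (λ u _ → index u) inj
    where
    index : Vertex G → Fin (suc k)
    index = onBlocks (k + s) classIndex (λ _ → fromℕ k)
    index-c : ∀ i → index (c i) ≡ classIndex i
    index-c = onBlocks-↑ˡ (k + s) _ _
    index-z : ∀ j → index (z j) ≡ fromℕ k
    index-z = onBlocks-↑ʳ (k + s) _ _
    inj : ∀ u v (p : u ∈ S) (q : v ∈ S) → index u ≡ index v → u ≡ v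
    inj u v p q e with u ≟ v
    ... | yes u≡v = u≡v
    ... | no u≢v with proj₁ (proj₂ (clique u v p q u≢v)) | block (k + s) (suc s) u | block (k + s) (suc s) v
    ...   | md | right j | right j′ with j ≟ j′
    ...     | yes refl = ⊥-elim (u≢v refl)
    ...     | no j≢j′ = ⊥-elim (¬maxDistant-zz j≢j′ md)
    inj u v p q e | no u≢v | md | left i | right j =
      ⊥-elim (classIndex≢k i (trans (sym (index-c i)) (trans e (index-z j))))
    inj u v p q e | no u≢v | md | right j | left i =
      ⊥-elim (classIndex≢k i (trans (sym (index-c i)) (trans (sym e) (index-z j))))
    inj u v p q e | no u≢v | md | left i | left i′ with cls i ≟ cls i′
    ...     | no ne = ⊥-elim (¬maxDistant-cc ne md)
    ...     | yes same = cong c (classIndex-injective same (trans (sym (index-c i)) (trans e (index-c i′))))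

  realises : Σ Graph (λ G → Connected G × GpNumber G (k + s) × SRCliqueNumber G (suc k))
  realises = G , GraphFacts.diameter≤2⇒connected G diameter≤2 , gpNumber two-classes
               , (SR-clique , SR-clique-isClique , ∣SR-clique∣) , SR-bound

-- The theorem: write t = a + 2 and r = t + b, so that r = (a + 1) + (b + 1).

proposition3p5 : (r t : ℕ) → 2 ≤ t → t ≤ r →
    Σ Graph (λ G → Connected G × GpNumber G r × SRCliqueNumber G t)
proposition3p5 r (suc (suc a)) (s≤s (s≤s z≤n)) t≤r with m≤n⇒∃[o]m+o≡n t≤r
... | b , t+b≡r = subst (λ r → Σ Graph (λ G → Connected G × GpNumber G r × SRCliqueNumber G (suc (suc a))))
                    (trans (+-suc (suc a) b) t+b≡r) (Example.realises a b)
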